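{- If a language $L$ has a subset of the form $x w^* y w^* z$ for some words $w, x, y, z$ with $wy \neq yw$, then $L$ does not have a finite separating set of factors.
   Context: For words $u, t$, $|u|_t$ is the number of pairs of words $(s,r)$ with $u = s t r$. A language $X$ is a separating set of factors of $L$ if for all distinct $u, v \in L$ there is $t \in X$ with $|u|_t \neq |v|_t$. -}

module Defs where

open import Data.Nat using (ℕ; zero; suc; _+_)
open import Data.List using (List; []; _∷_; _++_; replicate; concat)
open import Data.List.Membership.Propositional using (_∈_)
open import Data.Product using (Σ; ∃; _×_; _,_)
open import Relation.Binary.PropositionalEquality using (_≡_; _≢_)
open import Relation.Binary.Definitions using (DecidableEquality)
open import Relation.Nullary using (yes; no; ¬_)
open import Level using (Level; _⊔_; suc)

module _ {a : Level} {A : Set a} (_≟_ : DecidableEquality A) where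

  isPrefix : List A → List A → ℕ
  isPrefix [] u = 1
  isPrefix (x ∷ t) [] = 0
  isPrefix (x ∷ t) (y ∷ u) with x ≟ y
  ... | yes _ = isPrefix t u
  ... | no _ = 0

  -- |u|_t : number of pairs (s , r) with u = s ++ t ++ r,
  -- counted by the length of s (the start position of the occurrence)
  occ : List A → List A → ℕ
  occ t [] = isPrefix t []
  occ t (y ∷ u) = isPrefix t (y ∷ u) + occ t u

Language : {a : Level} → Set a → (ℓ : Level) → Set (a ⊔ Level.suc ℓ)
Language A ℓ = List A → Set ℓ

pow : {a : Level} {A : Set a} → List A → ℕ → List A
pow w n = concat (replicate n w)

module _ {a ℓ : Level} {A : Set a} (_≟_ : DecidableEquality A) where

  SeparatingFactors : List (List A) → Language A ℓ → Set (a ⊔ ℓ)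
  SeparatingFactors X L =
    ∀ u v → L u → L v → u ≢ v →
      Σ (List A) λ t → (t ∈ X) × (occ _≟_ t u ≢ occ _≟_ t v)

  HasFiniteSeparatingSet : Language A ℓ → Set (a ⊔ ℓ)
  HasFiniteSeparatingSet L = Σ (List (List A)) λ X → SeparatingFactors X L

module Submission where

-- Let X be a finite set of factors and K the maximal length of a word
-- in X.  Put Q = w^K, so that Q commutes with w and every t ∈ X satisfies
-- |t| ≤ K ≤ |Q|.  The two words of L
--     u = x Q y w Q z   ( = x w^K y w^(K+1) z )
--     v = x w Q y Q z   ( = x w^(K+1) y w^K z )
-- are distinct, because u = v would give y w = w y.  Yet no t ∈ X tells them
-- apart: cutting u and v into the blocks x, Q, y, w and the common tail Q z,
-- the occurrences of t starting in a block only depend on that block and on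
-- the first K letters after it, and these K-letter windows coincide for
-- corresponding blocks (a window starting with Q is the prefix of Q, and
-- w Q = Q w).

open import Defs
open import Level using (Level)
open import Data.Nat using (ℕ)
open import Data.List using (List; _++_)
open import Relation.Binary.PropositionalEquality using (_≢_)
open import Relation.Binary.Definitions using (DecidableEquality)
open import Relation.Nullary using (¬_)

open import Data.Nat using (zero; suc; _+_; _≤_; _⊓_; z≤n; s≤s)
open import Data.Nat.Properties
  using (≤-refl; ≤-trans; n≤1+n; m≤n⇒m⊓n≡m; +-assoc; +-commutativeSemigroup)
open import Data.List using ([]; _∷_; take; length; map)
open import Data.List.Properties
  using (take-take; length-++-≤ʳ; ++-assoc; ++-identityʳ; ++-cancelˡ; ++-cancelʳ; ∷-injective)
open import Data.List.Extrema.Nat using (max; xs≤max)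
open import Data.List.Relation.Unary.All using (lookup)
open import Data.List.Membership.Propositional using (_∈_)
open import Data.List.Membership.Propositional.Properties using (∈-map⁺)
open import Data.Product using (_,_)
open import Relation.Binary.PropositionalEquality using (_≡_; refl; sym; cong; cong₂; subst; module ≡-Reasoning)
open import Relation.Nullary using (yes; no)
open import Algebra.Properties.CommutativeSemigroup +-commutativeSemigroup using (x∙yz≈y∙xz)

module _ {a : Level} {A : Set a} where

  infix 4 _≈[_]_
  _≈[_]_ : List A → ℕ → List A → Set a
  u ≈[ k ] v = take k u ≡ take k v

  ≈-shorten : ∀ {j k} (u v : List A) → j ≤ k → u ≈[ k ] v → u ≈[ j ] v
  ≈-shorten {j} {k} u v j≤k u≈v = begin
    take j u           ≡⟨ cong (λ i → take i u) (m≤n⇒m⊓n≡m j≤k) ⟨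
    take (j ⊓ k) u     ≡⟨ take-take j k u ⟨
    take j (take k u)  ≡⟨ cong (take j) u≈v ⟩
    take j (take k v)  ≡⟨ take-take j k v ⟩
    take (j ⊓ k) v     ≡⟨ cong (λ i → take i v) (m≤n⇒m⊓n≡m j≤k) ⟩
    take j v           ∎
    where open ≡-Reasoning

  ≈-prepend : ∀ {k} (s u v : List A) → u ≈[ k ] v → s ++ u ≈[ k ] s ++ v
  ≈-prepend         []      u v u≈v = u≈v
  ≈-prepend {zero}  (c ∷ s) u v u≈v = refl
  ≈-prepend {suc k} (c ∷ s) u v u≈v =
    cong (c ∷_) (≈-prepend s u v (≈-shorten u v (n≤1+n k) u≈v))

  ≈-common-prefix : ∀ {k} (p r r′ : List A) → k ≤ length p → p ++ r ≈[ k ] p ++ r′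
  ≈-common-prefix {zero}  p       r r′ _         = refl
  ≈-common-prefix {suc k} (c ∷ p) r r′ (s≤s k≤p) = cong (c ∷_) (≈-common-prefix p r r′ k≤p)

  pow-commutes : ∀ (w : List A) n → w ++ pow w n ≡ pow w n ++ w
  pow-commutes w zero    = ++-identityʳ w
  pow-commutes w (suc n) = begin
    w ++ w ++ pow w n    ≡⟨ cong (w ++_) (pow-commutes w n) ⟩
    w ++ pow w n ++ w    ≡⟨ ++-assoc w (pow w n) w ⟨
    (w ++ pow w n) ++ w  ∎
    where open ≡-Reasoning

  pow-length : ∀ (c : A) (w : List A) n → n ≤ length (pow (c ∷ w) n)
  pow-length c w zero    = z≤n
  pow-length c w (suc n) =
    s≤s (≤-trans (pow-length c w n) (length-++-≤ʳ (pow (c ∷ w) n) {w}))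

  transposition-injective : ∀ (w Q x y r : List A) → w ++ Q ≡ Q ++ w →
    x ++ Q ++ y ++ w ++ r ≡ x ++ w ++ Q ++ y ++ r → y ++ w ≡ w ++ y
  transposition-injective w Q x y r wQ≡Qw u≡v =
    ++-cancelʳ r (y ++ w) (w ++ y) (++-cancelˡ Q _ _ (begin
      Q ++ (y ++ w) ++ r  ≡⟨ cong (Q ++_) (++-assoc y w r) ⟩
      Q ++ y ++ w ++ r    ≡⟨ ++-cancelˡ x _ _ u≡v ⟩
      w ++ Q ++ y ++ r    ≡⟨ ++-assoc w Q (y ++ r) ⟨
      (w ++ Q) ++ y ++ r  ≡⟨ cong (_++ y ++ r) wQ≡Qw ⟩
      (Q ++ w) ++ y ++ r  ≡⟨ ++-assoc Q w (y ++ r) ⟩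
      Q ++ w ++ y ++ r    ≡⟨ cong (Q ++_) (++-assoc w y r) ⟨
      Q ++ (w ++ y) ++ r  ∎))
    where open ≡-Reasoning

module Occurrences {a : Level} {A : Set a} (_≟_ : DecidableEquality A) where

  isPrefix-local : ∀ (t u v : List A) → u ≈[ length t ] v → isPrefix _≟_ t u ≡ isPrefix _≟_ t v
  isPrefix-local []      u       v        _ = refl
  isPrefix-local (c ∷ t) []      []       _ = refl
  isPrefix-local (c ∷ t) (d ∷ u) (d′ ∷ v) agree with ∷-injective agree
  ... | refl , u≈v with c ≟ d
  ...   | yes _ = isPrefix-local t u v u≈v
  ...   | no  _ = refl

  module _ (t : List A) where

    -- occFrom p q: the occurrences of t in p ++ q that start inside p.
    occFrom : List A → List A → ℕ
    occFrom []      q = 0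
    occFrom (c ∷ p) q = isPrefix _≟_ t (c ∷ p ++ q) + occFrom p q

    occ-++ : ∀ p q → occ _≟_ t (p ++ q) ≡ occFrom p q + occ _≟_ t q
    occ-++ []      q = refl
    occ-++ (c ∷ p) q = begin
      isPrefix _≟_ t (c ∷ p ++ q) + occ _≟_ t (p ++ q)
        ≡⟨ cong (isPrefix _≟_ t (c ∷ p ++ q) +_) (occ-++ p q) ⟩
      isPrefix _≟_ t (c ∷ p ++ q) + (occFrom p q + occ _≟_ t q)
        ≡⟨ +-assoc (isPrefix _≟_ t (c ∷ p ++ q)) (occFrom p q) _ ⟨
      occFrom (c ∷ p) q + occ _≟_ t q
        ∎
      where open ≡-Reasoning

    occFrom-local : ∀ {k} → length t ≤ k → ∀ p {q q′} → q ≈[ k ] q′ → occFrom p q ≡ occFrom p q′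
    occFrom-local t≤k []      q≈q′ = refl
    occFrom-local t≤k (c ∷ p) {q} {q′} q≈q′ = cong₂ _+_
      (isPrefix-local t (c ∷ p ++ q) (c ∷ p ++ q′)
        (≈-shorten _ _ t≤k (≈-prepend (c ∷ p) q q′ q≈q′)))
      (occFrom-local t≤k p q≈q′)

    occ-blocks : ∀ p₁ p₂ p₃ p₄ r → occ _≟_ t (p₁ ++ p₂ ++ p₃ ++ p₄ ++ r) ≡
      occFrom p₁ (p₂ ++ p₃ ++ p₄ ++ r) + (occFrom p₂ (p₃ ++ p₄ ++ r) +
        (occFrom p₃ (p₄ ++ r) + (occFrom p₄ r + occ _≟_ t r)))
    occ-blocks p₁ p₂ p₃ p₄ r = begin
      occ _≟_ t (p₁ ++ p₂ ++ p₃ ++ p₄ ++ r)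
        ≡⟨ occ-++ p₁ _ ⟩
      occFrom p₁ _ + occ _≟_ t (p₂ ++ p₃ ++ p₄ ++ r)
        ≡⟨ cong (occFrom p₁ _ +_) (occ-++ p₂ _) ⟩
      occFrom p₁ _ + (occFrom p₂ _ + occ _≟_ t (p₃ ++ p₄ ++ r))
        ≡⟨ cong (λ n → occFrom p₁ _ + (occFrom p₂ _ + n)) (occ-++ p₃ _) ⟩
      occFrom p₁ _ + (occFrom p₂ _ + (occFrom p₃ _ + occ _≟_ t (p₄ ++ r)))
        ≡⟨ cong (λ n → occFrom p₁ _ + (occFrom p₂ _ + (occFrom p₃ _ + n))) (occ-++ p₄ r) ⟩
      occFrom p₁ _ + (occFrom p₂ _ + (occFrom p₃ _ + (occFrom p₄ r + occ _≟_ t r)))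
        ∎
      where open ≡-Reasoning

    occ-transposition : ∀ (w Q x y z : List A) → w ++ Q ≡ Q ++ w → length t ≤ length Q →
      occ _≟_ t (x ++ Q ++ y ++ w ++ Q ++ z) ≡ occ _≟_ t (x ++ w ++ Q ++ y ++ Q ++ z)
    occ-transposition w Q x y z wQ≡Qw t≤Q = begin
      occ _≟_ t (x ++ Q ++ y ++ w ++ r)
        ≡⟨ occ-blocks x Q y w r ⟩
      occFrom x (Q ++ y ++ w ++ r) + (occFrom Q (y ++ w ++ r) +
        (occFrom y (w ++ r) + (occFrom w r + occ _≟_ t r)))
        ≡⟨ cong₂ _+_ after-x
             (cong₂ _+_ after-Q (cong₂ _+_ after-y (cong (_+ occ _≟_ t r) after-w))) ⟩
      occFrom x (w ++ Q ++ y ++ r) + (occFrom Q (y ++ r) +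
        (occFrom y r + (occFrom w (Q ++ y ++ r) + occ _≟_ t r)))
        ≡⟨ cong (occFrom x (w ++ Q ++ y ++ r) +_)
             (reorder (occFrom Q (y ++ r)) (occFrom y r) (occFrom w (Q ++ y ++ r)) (occ _≟_ t r)) ⟩
      occFrom x (w ++ Q ++ y ++ r) + (occFrom w (Q ++ y ++ r) +
        (occFrom Q (y ++ r) + (occFrom y r + occ _≟_ t r)))
        ≡⟨ occ-blocks x w Q y r ⟨
      occ _≟_ t (x ++ w ++ Q ++ y ++ r)
        ∎
      where
      open ≡-Reasoning
      r : List A
      r = Q ++ z
      local : ∀ p {q q′} → q ≈[ length Q ] q′ → occFrom p q ≡ occFrom p q′
      local = occFrom-local t≤Q
      -- Words starting with w Q start with Q, so their window is that of Q.
      wQ-window : ∀ s s′ → w ++ Q ++ s ≈[ length Q ] Q ++ s′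
      wQ-window s s′ = begin
        take (length Q) (w ++ Q ++ s)    ≡⟨ cong (take (length Q)) (++-assoc w Q s) ⟨
        take (length Q) ((w ++ Q) ++ s)  ≡⟨ cong (λ p → take (length Q) (p ++ s)) wQ≡Qw ⟩
        take (length Q) ((Q ++ w) ++ s)  ≡⟨ cong (take (length Q)) (++-assoc Q w s) ⟩
        take (length Q) (Q ++ w ++ s)    ≡⟨ ≈-common-prefix Q (w ++ s) s′ ≤-refl ⟩
        take (length Q) (Q ++ s′)        ∎
      after-x : occFrom x (Q ++ y ++ w ++ r) ≡ occFrom x (w ++ Q ++ y ++ r)
      after-x = local x (sym (wQ-window (y ++ r) (y ++ w ++ r)))
      after-Q : occFrom Q (y ++ w ++ r) ≡ occFrom Q (y ++ r)
      after-Q = local Q (≈-prepend y _ _ (wQ-window z z))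
      after-y : occFrom y (w ++ r) ≡ occFrom y r
      after-y = local y (wQ-window z z)
      after-w : occFrom w r ≡ occFrom w (Q ++ y ++ r)
      after-w = local w (≈-common-prefix Q z (y ++ r) ≤-refl)
      -- the blocks Q, y, w of u reappear in v in the order w, Q, y
      reorder : ∀ b c d e → b + (c + (d + e)) ≡ d + (b + (c + e))
      reorder b c d e = begin
        b + (c + (d + e))  ≡⟨ cong (b +_) (x∙yz≈y∙xz c d e) ⟩
        b + (d + (c + e))  ≡⟨ x∙yz≈y∙xz b d (c + e) ⟩
        d + (b + (c + e))  ∎

lemma6 : {a ℓ : Level} {A : Set a} (_≟_ : DecidableEquality A) (L : Language A ℓ)
         (w x y z : List A) →
         w ++ y ≢ y ++ w →
         (∀ (m n : ℕ) → L (x ++ pow w m ++ y ++ pow w n ++ z)) →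
         ¬ HasFiniteSeparatingSet _≟_ L
-- The empty word commutes with y, so w is nonempty and w^K has length ≥ K.
lemma6 _≟_ L []       x y z wy≢yw _  _ = wy≢yw (sym (++-identityʳ y))
lemma6 _≟_ L (c ∷ w₀) x y z wy≢yw inL (X , separates) =
  let t , t∈X , counts-differ = separates u v u∈L v∈L u≢v
  in counts-differ (Occurrences.occ-transposition _≟_ t w Q x y z (pow-commutes w K) (short t∈X))
  where
  w : List _
  w = c ∷ w₀
  K : ℕ
  K = max 0 (map length X)
  Q : List _
  Q = pow w K
  u v : List _
  u = x ++ Q ++ y ++ w ++ Q ++ z
  v = x ++ w ++ Q ++ y ++ Q ++ z
  -- u = x w^K y w^(K+1) z  and  v = x w^(K+1) y w^K z,  up to associativity
  u∈L : L u
  u∈L = subst L (cong (λ s → x ++ Q ++ y ++ s) (++-assoc w Q z)) (inL K (suc K))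
  v∈L : L v
  v∈L = subst L (cong (x ++_) (++-assoc w Q (y ++ Q ++ z))) (inL (suc K) K)
  u≢v : u ≢ v
  u≢v u≡v = wy≢yw (sym (transposition-injective w Q x y (Q ++ z) (pow-commutes w K) u≡v))
  short : ∀ {t} → t ∈ X → length t ≤ length Q
  short t∈X = ≤-trans (lookup (xs≤max 0 (map length X)) (∈-map⁺ length t∈X)) (pow-length c w₀ K)
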